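{- Let $U$ and $V$ be two sets with counting sequences $K(U)$ and $K(V)$. Then the counting sequence of $W = U\times V$ (with square ordering) is $K(U\times V) = K(U) \cdot K(V)$ and the magnum of the product is $m(U\times V) = m(U)\cdot m(V)$.
   Context: $U$ and $V$ are countable ordered sets (subsets of a common enumerated reference set $R$), partitioned into finite components $\{U_m:m\in\mathbb{N}\}$ and $\{V_n:n\in\mathbb{N}\}$, ordered so that if $k_1\in U_{m_1}$, $k_2\in U_{m_2}$ and $m_1<m_2$ then $k_1<k_2$ (and similarly for $V$). For a set $A$ with such a partition $\{A_n\}$, the indicator sequence is $X_A(n)=|A_n|$ and the counting sequence is $K_A(n)=\sum_{k=1}^n X_A(k)$. The square ordering of $W=U\times V$ is given by the components $W_n = \biguplus_{k,\ell} \{ U_k\times V_\ell : \max\{k,\ell\}=n \}$, so $W=\biguplus_n W_n$, with $X_W(n)=|W_n|$ and $K_W(n)=\sum_{k=1}^n X_W(k)$. Counting sequences $f:\mathbb{N}\to\mathbb{N}_0$ are extended to $\hat f$ on the surnatural numbers (non-negative omnific integers) under the Axiom of Extension, which posits that extensions of nondecreasing functions preserve eventual equality, eventual strict inequality, sums, products and compositions. The magnum of $A\subseteq R$ relative to $R$ (where $R$ has magnum $\theta$ and a fenestration with partition function $\Lambda$) is $m(A|R)=\hat{K_A}(\hat\Lambda^{ -1}(\theta))$; for subsets of $\mathbb{N}$ with its canonical ordering this is $m(A)=\hat{\kappa_A}(\omega)$. -}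

module Defs where

open import Data.Nat using (ℕ; zero; suc; _+_; _*_; _≤_; _⊔_)
open import Data.List using (List; []; _∷_; length; map; concatMap; filter; upTo)
open import Data.Product using (_×_; _,_; ∃-syntax)
open import Relation.Binary.PropositionalEquality using (_≡_)
open import Data.Nat.Properties using (_≟_)

-- A countable ordered set presented by its partition into finite components.
-- Component m (for m ≥ 1) is the finite list  comp m ; index 0 is unused.
-- (The order inside and between components plays no role in the counting sequence.)
record Partitioned (A : Set) : Set where
  field
    comp : ℕ → List A

open Partitioned public

oneTo : ℕ → List ℕ
oneTo n = map suc (upTo n)

X : {A : Set} → Partitioned A → ℕ → ℕ
X P n = length (comp P n)

sum1to : (ℕ → ℕ) → ℕ → ℕ
sum1to f zero = 0
sum1to f (suc n) = sum1to f n + f (suc n)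

K : {A : Set} → Partitioned A → ℕ → ℕ
K P = sum1to (X P)

prodList : {A B : Set} → List A → List B → List (A × B)
prodList xs ys = concatMap (λ x → map (λ y → (x , y)) ys) xs

squareComp : {A B : Set} → Partitioned A → Partitioned B → ℕ → List (A × B)
squareComp U V n =
  concatMap (λ k →
    concatMap (λ l → prodList (comp U k) (comp V l))
              (filter (λ l → (k ⊔ l) ≟ n) (oneTo n)))
    (oneTo n)

squareProduct : {A B : Set} → Partitioned A → Partitioned B → Partitioned (A × B)
squareProduct U V = record { comp = squareComp U V }

Nondecreasing : (ℕ → ℕ) → Set
Nondecreasing f = ∀ {m n} → m ≤ n → f m ≤ f n

EventuallyEqual : (ℕ → ℕ) → (ℕ → ℕ) → Set
EventuallyEqual f g = ∃[ N ] (∀ n → N ≤ n → f n ≡ g n)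

-- Abstract model of the surnatural numbers together with the extension
-- f ↦ f̂ of counting sequences, satisfying (the relevant clauses of) the
-- Axiom of Extension, and a designated evaluation point (ω for subsets of ℕ,
-- or Λ̂⁻¹(θ) for the relative magnum).
record SurnaturalExtension : Set₁ where
  field
    Sur   : Set
    _·_   : Sur → Sur → Sur
    ext   : (ℕ → ℕ) → Sur → Sur
    point : Sur
    ext-eventual : ∀ f g → Nondecreasing f → Nondecreasing g →
                   EventuallyEqual f g → ∀ x → ext f x ≡ ext g x
    ext-product  : ∀ f g → Nondecreasing f → Nondecreasing g →
                   ∀ x → ext (λ n → f n * g n) x ≡ ext f x · ext g x

open SurnaturalExtension public

magnum : (E : SurnaturalExtension) {A : Set} → Partitioned A → Sur E
magnum E P = ext E (K P) (point E)

{-# OPTIONS --safe #-}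

-- Each element of W_n lies in U_k × V_ℓ with either k < n = ℓ or k = n ≥ ℓ, so
-- |W_{n+1}| = K_U(n) X_V(n+1) + X_U(n+1) K_V(n+1), which is exactly the increment
-- of K_U K_V from n to n+1.  Both K_W and K_U K_V are nondecreasing, so the Axiom
-- of Extension turns this identity into m(U × V) = m(U) · m(V).
module Submission where

open import Defs
open import Data.Nat using (ℕ; zero; suc; z≤n; s≤s; s≤s⁻¹; _+_; _*_; _≤_; _⊔_)
open import Data.Nat.Properties
  using (_≟_; ≤-refl; ≤-trans; n≤1+n; m≤m+n; m≤n⇒m<n∨m≡n; <⇒≢
        ; m≤n⇒m⊔n≡n; m≥n⇒m⊔n≡m; ⊔-lub; *-mono-≤; +-identityʳ
        ; *-zeroʳ; *-distribˡ-+; *-distribʳ-+)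
open import Data.Nat.ListAction using (sum)
open import Data.Nat.ListAction.Properties using (sum-++)
open import Data.Nat.Tactic.RingSolver using (solve-∀)
open import Data.List using (List; []; _∷_; _++_; [_]; length; map; concatMap; filter; upTo)
open import Data.List.Properties
  using (length-++; length-map; map-++; map-cong; map-cong-local; upTo-∷ʳ; filter-++; filter-all; filter-none; filter-accept)
open import Data.List.Relation.Unary.All using (All)
import Data.List.Relation.Unary.All as All
open import Data.List.Relation.Unary.All.Properties using (map⁺; all-upTo)
open import Data.Product using (_×_; _,_)
open import Function using (_∘_)
open import Data.Sum using (inj₁; inj₂)
open import Relation.Binary.PropositionalEquality
  using (_≡_; _≢_; refl; sym; trans; cong; cong₂; module ≡-Reasoning)

private
  variable
    A B : Set

sum-map-*ˡ : (c : ℕ) (f : A → ℕ) (xs : List A) → sum (map (λ x → c * f x) xs) ≡ c * sum (map f xs)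
sum-map-*ˡ c f []       = sym (*-zeroʳ c)
sum-map-*ˡ c f (x ∷ xs) = trans (cong (c * f x +_) (sum-map-*ˡ c f xs)) (sym (*-distribˡ-+ c (f x) _))

sum-map-*ʳ : (c : ℕ) (f : A → ℕ) (xs : List A) → sum (map (λ x → f x * c) xs) ≡ sum (map f xs) * c
sum-map-*ʳ c f []       = refl
sum-map-*ʳ c f (x ∷ xs) = trans (cong (f x * c +_) (sum-map-*ʳ c f xs)) (sym (*-distribʳ-+ c (f x) _))

length-concatMap : (f : A → List B) (xs : List A) → length (concatMap f xs) ≡ sum (map (λ x → length (f x)) xs)
length-concatMap f []       = refl
length-concatMap f (x ∷ xs) = trans (length-++ (f x)) (cong (length (f x) +_) (length-concatMap f xs))

length-prodList : (xs : List A) (ys : List B) → length (prodList xs ys) ≡ length xs * length ys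
length-prodList xs ys = trans (length-concatMap _ xs) (go xs)
  where
  go : ∀ zs → sum (map (λ x → length (map (x ,_) ys)) zs) ≡ length zs * length ys
  go []       = refl
  go (z ∷ zs) = cong₂ _+_ (length-map (z ,_) ys) (go zs)

oneTo-suc : (n : ℕ) → oneTo (suc n) ≡ oneTo n ++ [ suc n ]
oneTo-suc n = trans (cong (map suc) (sym (upTo-∷ʳ n))) (map-++ suc (upTo n) [ n ])

oneTo-≤ : (n : ℕ) → All (_≤ n) (oneTo n)
oneTo-≤ n = map⁺ (all-upTo n)

sum-map-oneTo-suc : (f : ℕ → ℕ) (n : ℕ) → sum (map f (oneTo (suc n))) ≡ sum (map f (oneTo n)) + f (suc n)
sum-map-oneTo-suc f n = begin
  sum (map f (oneTo (suc n)))                   ≡⟨ cong (sum ∘ map f) (oneTo-suc n) ⟩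
  sum (map f (oneTo n ++ [ suc n ]))            ≡⟨ cong sum (map-++ f (oneTo n) _) ⟩
  sum (map f (oneTo n) ++ [ f (suc n) ])        ≡⟨ sum-++ (map f (oneTo n)) _ ⟩
  sum (map f (oneTo n)) + (f (suc n) + 0)       ≡⟨ cong (sum (map f (oneTo n)) +_) (+-identityʳ _) ⟩
  sum (map f (oneTo n)) + f (suc n)             ∎
  where open ≡-Reasoning

sum1to-oneTo : (f : ℕ → ℕ) (n : ℕ) → sum1to f n ≡ sum (map f (oneTo n))
sum1to-oneTo f zero    = refl
sum1to-oneTo f (suc n) = trans (cong (_+ f (suc n)) (sum1to-oneTo f n)) (sym (sum-map-oneTo-suc f n))

filter-⊔≟-below : {k n : ℕ} → k ≤ n → filter (λ l → k ⊔ l ≟ suc n) (oneTo (suc n)) ≡ [ suc n ]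
filter-⊔≟-below {k} {n} k≤n = begin
  filter P? (oneTo (suc n))                        ≡⟨ cong (filter P?) (oneTo-suc n) ⟩
  filter P? (oneTo n ++ [ suc n ])                 ≡⟨ filter-++ P? (oneTo n) [ suc n ] ⟩
  filter P? (oneTo n) ++ filter P? [ suc n ]       ≡⟨ cong₂ _++_ (filter-none P? (All.map below (oneTo-≤ n)))
                                                              (filter-accept P? (m≤n⇒m⊔n≡n (≤-trans k≤n (n≤1+n n)))) ⟩
  [ suc n ]                                        ∎
  where
  open ≡-Reasoning
  P? = λ l → k ⊔ l ≟ suc n
  below : ∀ {l} → l ≤ n → k ⊔ l ≢ suc n
  below l≤n = <⇒≢ (s≤s (⊔-lub k≤n l≤n))

filter-⊔≟-diag : (n : ℕ) → filter (λ l → n ⊔ l ≟ n) (oneTo n) ≡ oneTo n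
filter-⊔≟-diag n = filter-all (λ l → n ⊔ l ≟ n) (All.map m≥n⇒m⊔n≡m (oneTo-≤ n))

module _ (U : Partitioned A) (V : Partitioned B) where

  X-squareProduct : (n : ℕ) → X (squareProduct U V) n ≡
    sum (map (λ k → X U k * sum (map (X V) (filter (λ l → k ⊔ l ≟ n) (oneTo n)))) (oneTo n))
  X-squareProduct n = trans (length-concatMap _ (oneTo n)) (cong sum (map-cong rowLength (oneTo n)))
    where
    row : ℕ → List ℕ
    row k = filter (λ l → k ⊔ l ≟ n) (oneTo n)

    rowLength : ∀ k → length (concatMap (λ l → prodList (comp U k) (comp V l)) (row k))
                      ≡ X U k * sum (map (X V) (row k))
    rowLength k = begin
      length (concatMap (λ l → prodList (comp U k) (comp V l)) (row k))  ≡⟨ length-concatMap _ (row k) ⟩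
      sum (map (λ l → length (prodList (comp U k) (comp V l))) (row k))   ≡⟨ cong sum (map-cong (λ l → length-prodList (comp U k) (comp V l)) (row k)) ⟩
      sum (map (λ l → X U k * X V l) (row k))                             ≡⟨ sum-map-*ˡ (X U k) (X V) (row k) ⟩
      X U k * sum (map (X V) (row k))                                     ∎
      where open ≡-Reasoning

  X-squareProduct-suc : (n : ℕ) →
    X (squareProduct U V) (suc n) ≡ K U n * X V (suc n) + X U (suc n) * K V (suc n)
  X-squareProduct-suc n = begin
    X (squareProduct U V) (suc n)                      ≡⟨ X-squareProduct (suc n) ⟩
    sum (map rowCount (oneTo (suc n)))                 ≡⟨ sum-map-oneTo-suc rowCount n ⟩
    sum (map rowCount (oneTo n)) + rowCount (suc n)    ≡⟨ cong₂ _+_ lowerRows lastRow ⟩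
    K U n * X V (suc n) + X U (suc n) * K V (suc n)    ∎
    where
    open ≡-Reasoning
    rowCount : ℕ → ℕ
    rowCount k = X U k * sum (map (X V) (filter (λ l → k ⊔ l ≟ suc n) (oneTo (suc n))))

    lowerRow : ∀ {k} → k ≤ n → rowCount k ≡ X U k * X V (suc n)
    lowerRow {k} k≤n = cong (X U k *_)
      (trans (cong (sum ∘ map (X V)) (filter-⊔≟-below k≤n)) (+-identityʳ _))

    lowerRows : sum (map rowCount (oneTo n)) ≡ K U n * X V (suc n)
    lowerRows = begin
      sum (map rowCount (oneTo n))                         ≡⟨ cong sum (map-cong-local (All.map lowerRow (oneTo-≤ n))) ⟩
      sum (map (λ k → X U k * X V (suc n)) (oneTo n))      ≡⟨ sum-map-*ʳ (X V (suc n)) (X U) (oneTo n) ⟩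
      sum (map (X U) (oneTo n)) * X V (suc n)              ≡⟨ cong (_* X V (suc n)) (sym (sum1to-oneTo (X U) n)) ⟩
      K U n * X V (suc n)                                  ∎

    lastRow : rowCount (suc n) ≡ X U (suc n) * K V (suc n)
    lastRow = cong (X U (suc n) *_)
      (trans (cong (sum ∘ map (X V)) (filter-⊔≟-diag (suc n))) (sym (sum1to-oneTo (X V) (suc n))))

  K-squareProduct : (n : ℕ) → K (squareProduct U V) n ≡ K U n * K V n
  K-squareProduct zero    = refl
  K-squareProduct (suc n) = begin
    K (squareProduct U V) n + X (squareProduct U V) (suc n)
      ≡⟨ cong₂ _+_ (K-squareProduct n) (X-squareProduct-suc n) ⟩
    K U n * K V n + (K U n * X V (suc n) + X U (suc n) * (K V n + X V (suc n)))
      ≡⟨ expand (K U n) (K V n) (X U (suc n)) (X V (suc n)) ⟩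
    (K U n + X U (suc n)) * (K V n + X V (suc n))      ∎
    where
    open ≡-Reasoning
    expand : ∀ a b x y → a * b + (a * y + x * (b + y)) ≡ (a + x) * (b + y)
    expand = solve-∀

nondecreasing-step : (f : ℕ → ℕ) → (∀ n → f n ≤ f (suc n)) → Nondecreasing f
nondecreasing-step f step {n = zero}  z≤n = ≤-refl
nondecreasing-step f step {n = suc n} m≤n with m≤n⇒m<n∨m≡n m≤n
... | inj₁ m<1+n = ≤-trans (nondecreasing-step f step (s≤s⁻¹ m<1+n)) (step n)
... | inj₂ refl  = ≤-refl

K-nondecreasing : (P : Partitioned A) → Nondecreasing (K P)
K-nondecreasing P = nondecreasing-step (K P) (λ n → m≤m+n (K P n) (X P (suc n)))

theorem22 : (E : SurnaturalExtension) {A B : Set} (U : Partitioned A) (V : Partitioned B) →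
    ((n : ℕ) → K (squareProduct U V) n ≡ K U n * K V n)
    × (magnum E (squareProduct U V) ≡ _·_ E (magnum E U) (magnum E V))
theorem22 E U V = K-squareProduct U V , magnum-squareProduct
  where
  KUKV-nondecreasing : Nondecreasing (λ n → K U n * K V n)
  KUKV-nondecreasing m≤n = *-mono-≤ (K-nondecreasing U m≤n) (K-nondecreasing V m≤n)

  magnum-squareProduct : magnum E (squareProduct U V) ≡ _·_ E (magnum E U) (magnum E V)
  magnum-squareProduct = begin
    ext E (K (squareProduct U V)) (point E)   ≡⟨ ext-eventual E _ _ (K-nondecreasing (squareProduct U V)) KUKV-nondecreasing
                                                  (0 , λ n _ → K-squareProduct U V n) (point E) ⟩
    ext E (λ n → K U n * K V n) (point E)     ≡⟨ ext-product E (K U) (K V) (K-nondecreasing U) (K-nondecreasing V) (point E) ⟩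
    _·_ E (magnum E U) (magnum E V)           ∎
    where open ≡-Reasoning
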